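{- Let $\Gamma$ be a finite simple graph with structural equivalence classes $C_1,\dots,C_{s}$ (where $s=s(\Gamma)$), and let $\gamma_i=|C_i|$. For each $i$, let $S_{\gamma_i,i}$ denote the group of all permutations of $V(\Gamma)$ that fix every vertex outside $C_i$ (a copy of the symmetric group on $C_i$). Then \[ SEP(\Gamma)=\Big\langle \bigcup_{i=1}^{s} S_{\gamma_i,i}\Big\rangle \cong \prod_{i=1}^{s} S_{\gamma_i,i}, \] and $|SEP(\Gamma)|=\prod_{i=1}^{s}\gamma_i!$.
   Context: Two vertices $u,v$ of a graph $\Gamma$ are structurally equivalent if the transposition $(u\,v)$ (swapping $u,v$ and fixing all other vertices) is an automorphism of $\Gamma$ (a vertex is considered structurally equivalent to itself). Structural equivalence is an equivalence relation on $V(\Gamma)$; its classes are the structural equivalence classes, and $s(\Gamma)$ denotes their number. The structural equivalence permutation group is $SEP(\Gamma)=\langle\{(u\,v) : (u\,v)\in \mathrm{Aut}(\Gamma)\}\rangle$, a subgroup of the symmetric group on $V(\Gamma)$. -}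

module Defs where

open import Data.Nat.Base using (ℕ; zero; suc; _*_)
open import Data.Bool.Base using (Bool; false)
open import Data.Fin.Base using (Fin; zero; suc)
open import Data.Fin.Permutation using (Permutation′; _⟨$⟩ʳ_; _≈_; _∘ₚ_; id; flip; transpose)
open import Data.List.Base using (length; filter; allFin)
open import Data.Fin.Properties using (_≟_)
open import Data.Product.Base using (Σ; ∃; _×_)
open import Function.Bundles using (_⇔_)
open import Relation.Binary.PropositionalEquality using (_≡_; _≢_)

record Graph (n : ℕ) : Set where
  field
    adj    : Fin n → Fin n → Bool
    adj-sym : ∀ u v → adj u v ≡ adj v u
    irrefl : ∀ v → adj v v ≡ false
open Graph public

Perm : ℕ → Set
Perm n = Permutation′ n

IsAut : ∀ {n} → Graph n → Perm n → Set
IsAut Γ σ = ∀ u v → adj Γ (σ ⟨$⟩ʳ u) (σ ⟨$⟩ʳ v) ≡ adj Γ u v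

StructEq : ∀ {n} → Graph n → Fin n → Fin n → Set
StructEq Γ u v = IsAut Γ (transpose u v)

data Gen {n : ℕ} (S : Perm n → Set) : Perm n → Set where
  gen  : ∀ {σ} → S σ → Gen S σ
  one  : Gen S id
  comp : ∀ {σ τ} → Gen S σ → Gen S τ → Gen S (σ ∘ₚ τ)
  inv  : ∀ {σ} → Gen S σ → Gen S (flip σ)
  resp : ∀ {σ τ} → σ ≈ τ → Gen S σ → Gen S τ

SEP : ∀ {n} → Graph n → Perm n → Set
SEP {n} Γ = Gen (λ σ → Σ (Fin n) λ u → Σ (Fin n) λ v → StructEq Γ u v × σ ≈ transpose u v)

-- An enumeration C_0, …, C_{s-1} of the structural equivalence classes of Γ:
-- class c v contains v; every label is used; c u ≡ c v iff u, v are
-- structurally equivalent.  (Then s = s(Γ).)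
record ClassLabeling {n : ℕ} (Γ : Graph n) (s : ℕ) : Set where
  field
    cls     : Fin n → Fin s
    cls-surj : ∀ i → ∃ λ v → cls v ≡ i
    cls-spec : ∀ u v → (cls u ≡ cls v) ⇔ StructEq Γ u v
open ClassLabeling public

module _ {n s : ℕ} {Γ : Graph n} (L : ClassLabeling Γ s) where

  classSize : Fin s → ℕ
  classSize i = length (filter (λ v → cls L v ≟ i) (allFin n))

  InSym : Fin s → Perm n → Set
  InSym i σ = ∀ w → cls L w ≢ i → σ ⟨$⟩ʳ w ≡ w

  InUnion : Perm n → Set
  InUnion σ = Σ (Fin s) λ i → InSym i σ

  InProd : (Fin s → Perm n) → Set
  InProd f = ∀ i → InSym i (f i)

∏ : ∀ {s} → (Fin s → ℕ) → ℕ
∏ {zero}  f = 1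
∏ {suc s} f = f zero * ∏ (λ i → f (suc i))

-- A group isomorphism ∏_i S_{γ_i,i} ≅ SEP(Γ): a map ψ from the product
-- (group law: componentwise composition, equality: componentwise ≈)
-- to permutations that is well defined, a homomorphism, injective,
-- lands in SEP(Γ) and is onto SEP(Γ).
record ProdIso {n s : ℕ} {Γ : Graph n} (L : ClassLabeling Γ s) : Set where
  field
    ψ      : (Fin s → Perm n) → Perm n
    ψ-resp : ∀ f g → InProd L f → InProd L g → (∀ i → f i ≈ g i) → ψ f ≈ ψ g
    ψ-hom  : ∀ f g → InProd L f → InProd L g →
             ψ (λ i → f i ∘ₚ g i) ≈ (ψ f ∘ₚ ψ g)
    ψ-inj  : ∀ f g → InProd L f → InProd L g → ψ f ≈ ψ g → ∀ i → f i ≈ g i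
    ψ-into : ∀ f → InProd L f → SEP Γ (ψ f)
    ψ-onto : ∀ σ → SEP Γ σ → Σ (Fin s → Perm n) λ f → InProd L f × ψ f ≈ σ

HasCard : ∀ {n} → (Perm n → Set) → ℕ → Set
HasCard {n} P N =
  Σ (Fin N → Perm n) λ e →
    (∀ k → P (e k)) ×
    (∀ k k′ → e k ≈ e k′ → k ≡ k′) ×
    (∀ σ → P σ → Σ (Fin N) λ k → e k ≈ σ)

-- Both SEP(Γ) and ⟨⋃ᵢ S_{γᵢ,i}⟩ are the group of permutations mapping every
-- class Cᵢ onto itself: every generator of either group preserves the classes,
-- and conversely a class-preserving σ is a product of transpositions inside
-- classes (compose with (σ(d) d) for each vertex d in turn). A class-preserving
-- σ is uniquely the product of its restrictions to the classes, which gives the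
-- isomorphism with ∏ᵢ S_{γᵢ,i}. Finally a permutation supported on a list of
-- m + 1 distinct vertices is determined by the image of the first vertex
-- (m + 1 choices) and a permutation supported on the other m, so
-- |S_{γᵢ,i}| = γᵢ!.
module Submission where

open import Defs
open import Data.Nat.Base using (ℕ; zero; suc; _*_; _!)
open import Data.Fin.Base using (Fin; zero; suc; remQuot; combine)
open import Data.Fin.Properties using (_≟_; all?; remQuot-combine; combine-remQuot)
open import Data.Fin.Permutation
  using (permutation; _⟨$⟩ʳ_; _⟨$⟩ˡ_; _≈_; _∘ₚ_; id; flip; transpose; inverseˡ; inverseʳ)
open import Data.List.Base using (List; []; _∷_; length; lookup; filter; allFin)
open import Data.List.Membership.Propositional using (_∈_; _∉_)
open import Data.List.Membership.Propositional.Properties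
  using (∈-lookup; ∈-filter⁺; ∈-filter⁻; ∈-allFin)
open import Data.List.Relation.Unary.Any using (here; there; index)
open import Data.List.Relation.Unary.Any.Properties using (lookup-index)
open import Data.List.Relation.Unary.AllPairs using (_∷_)
open import Data.List.Relation.Unary.Unique.Propositional using (Unique)
open import Data.List.Relation.Unary.Unique.Propositional.Properties
  using (Unique[x∷xs]⇒x∉xs; filter⁺; allFin⁺)
import Data.Vec.Functional as Vector
open import Data.Vec.Functional.Relation.Binary.Equality.Setoid using (≋-setoid)
open import Data.Product.Base using (Σ; _×_; _,_; proj₁; proj₂)
open import Level using (0ℓ)
open import Relation.Binary.Bundles using (Setoid)
open import Function.Bundles using (_⇔_; mk⇔; Equivalence; Injection)
open import Function.Construct.Composition using (_⇔-∘_)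
open import Function.Construct.Symmetry using (⇔-sym)
open import Function.Properties.Inverse using (↔⇒↣)
open import Relation.Binary.PropositionalEquality
  using (_≡_; _≢_; refl; sym; trans; cong; cong₂; subst; module ≡-Reasoning)
open import Relation.Nullary using (yes; no; Dec; contradiction)

private
  variable
    n : ℕ

∘ₚ-cancelʳ : {σ τ ρ : Perm n} → (σ ∘ₚ ρ) ≈ (τ ∘ₚ ρ) → σ ≈ τ
∘ₚ-cancelʳ {ρ = ρ} eq i =
  trans (sym (inverseˡ ρ)) (trans (cong (ρ ⟨$⟩ˡ_) (eq i)) (inverseˡ ρ))

⟨$⟩ʳ-injective : (σ : Perm n) {u v : Fin n} → σ ⟨$⟩ʳ u ≡ σ ⟨$⟩ʳ v → u ≡ v
⟨$⟩ʳ-injective σ = Injection.injective (↔⇒↣ σ)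

transpose-matchˡ : (u v : Fin n) → transpose u v ⟨$⟩ʳ u ≡ v
transpose-matchˡ u v with u ≟ u
... | yes _   = refl
... | no u≢u = contradiction refl u≢u

transpose-mismatch : {u v w : Fin n} → w ≢ u → w ≢ v → transpose u v ⟨$⟩ʳ w ≡ w
transpose-mismatch {u = u} {v} {w} w≢u w≢v with w ≟ u
... | yes w≡u = contradiction w≡u w≢u
... | no _ with w ≟ v
...   | yes w≡v = contradiction w≡v w≢v
...   | no _    = refl

record IsSubgroup (P : Perm n → Set) : Set where
  field
    id-∈   : P id
    ∘-∈    : ∀ {σ τ} → P σ → P τ → P (σ ∘ₚ τ)
    flip-∈ : ∀ {σ} → P σ → P (flip σ)
    ≈-∈    : ∀ {σ τ} → σ ≈ τ → P σ → P τ

open IsSubgroup using (id-∈; ∘-∈; flip-∈; ≈-∈)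

Gen-minimal : {S P : Perm n → Set} → IsSubgroup P → (∀ {σ} → S σ → P σ) →
              ∀ {σ} → Gen S σ → P σ
Gen-minimal H S⊆P (gen σ∈S)     = S⊆P σ∈S
Gen-minimal H S⊆P one           = id-∈ H
Gen-minimal H S⊆P (comp σ∈ τ∈)  = ∘-∈ H (Gen-minimal H S⊆P σ∈) (Gen-minimal H S⊆P τ∈)
Gen-minimal H S⊆P (inv σ∈)      = flip-∈ H (Gen-minimal H S⊆P σ∈)
Gen-minimal H S⊆P (resp σ≈τ σ∈) = ≈-∈ H σ≈τ (Gen-minimal H S⊆P σ∈)

SupportedIn : List (Fin n) → Perm n → Set
SupportedIn l σ = ∀ w → w ∉ l → σ ⟨$⟩ʳ w ≡ w

supportedIn-peel : ∀ {d l} {σ : Perm n} → SupportedIn (d ∷ l) σ →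
                   SupportedIn l (σ ∘ₚ transpose (σ ⟨$⟩ʳ d) d)
supportedIn-peel {d = d} {σ = σ} fix w w∉l with w ≟ d
... | yes refl = transpose-matchˡ (σ ⟨$⟩ʳ d) d
... | no w≢d   = trans (cong (transpose (σ ⟨$⟩ʳ d) d ⟨$⟩ʳ_) σw≡w)
                       (transpose-mismatch w≢σd w≢d)
  where
  σw≡w : σ ⟨$⟩ʳ w ≡ w
  σw≡w = fix w λ { (here w≡d) → w≢d w≡d ; (there w∈l) → w∉l w∈l }
  w≢σd : w ≢ σ ⟨$⟩ʳ d
  w≢σd w≡σd = w≢d (⟨$⟩ʳ-injective σ (trans σw≡w w≡σd))

module _ {A : Set} (c : Fin n → A) where

  ClassPreserving : Perm n → Set
  ClassPreserving σ = ∀ v → c (σ ⟨$⟩ʳ v) ≡ c v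

  classPreserving-isSubgroup : IsSubgroup ClassPreserving
  classPreserving-isSubgroup = record
    { id-∈   = λ _ → refl
    ; ∘-∈    = λ {σ} σ-cp τ-cp v → trans (τ-cp (σ ⟨$⟩ʳ v)) (σ-cp v)
    ; flip-∈ = λ {σ} σ-cp v → trans (sym (σ-cp (σ ⟨$⟩ˡ v))) (cong c (inverseʳ σ))
    ; ≈-∈    = λ σ≈τ σ-cp v → trans (cong c (sym (σ≈τ v))) (σ-cp v)
    }

  transpose-classPreserving : ∀ {u v} → c u ≡ c v → ClassPreserving (transpose u v)
  transpose-classPreserving {u} {v} cu≡cv w with w ≟ u
  ... | yes refl = sym cu≡cv
  ... | no _ with w ≟ v
  ...   | yes refl = cu≡cv
  ...   | no _     = refl

  module _ {S : Perm n → Set}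
           (transpose-∈ : ∀ {u v} → c u ≡ c v → Gen S (transpose u v)) where

    supportedIn⇒Gen : ∀ l σ → ClassPreserving σ → SupportedIn l σ → Gen S σ
    supportedIn⇒Gen [] σ _ fix = resp (λ v → sym (fix v λ ())) one
    supportedIn⇒Gen (d ∷ l) σ σ-cp fix =
      resp (λ _ → inverseˡ t)
           (comp (supportedIn⇒Gen l (σ ∘ₚ t) σt-cp (supportedIn-peel {σ = σ} fix))
                 (inv (transpose-∈ (σ-cp d))))
      where
      t = transpose (σ ⟨$⟩ʳ d) d
      σt-cp : ClassPreserving (σ ∘ₚ t)
      σt-cp = ∘-∈ classPreserving-isSubgroup {σ} {t} σ-cp (transpose-classPreserving (σ-cp d))

    classPreserving⇒Gen : ∀ {σ} → ClassPreserving σ → Gen S σ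
    classPreserving⇒Gen {σ} σ-cp =
      supportedIn⇒Gen (allFin n) σ σ-cp (λ v v∉ → contradiction (∈-allFin v) v∉)

≈-setoid : ℕ → Setoid 0ℓ 0ℓ
≈-setoid n = record
  { Carrier       = Perm n
  ; _≈_           = _≈_
  ; isEquivalence = record
    { refl  = λ _ → refl
    ; sym   = λ σ≈τ i → sym (σ≈τ i)
    ; trans = λ σ≈τ τ≈ρ i → trans (σ≈τ i) (τ≈ρ i)
    }
  }

Enumeration : (S : Setoid 0ℓ 0ℓ) → (Setoid.Carrier S → Set) → ℕ → Set
Enumeration S A N =
  Σ (Fin N → Carrier) λ e →
    (∀ k → A (e k)) ×
    (∀ k k′ → e k ≈ₛ e k′ → k ≡ k′) ×
    (∀ x → A x → Σ (Fin N) λ k → e k ≈ₛ x)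
  where open Setoid S renaming (_≈_ to _≈ₛ_)

enumeration-cong : ∀ S {A B : Setoid.Carrier S → Set} {N} →
                   (∀ {x} → A x ⇔ B x) → Enumeration S A N → Enumeration S B N
enumeration-cong S A⇔B (e , e-∈ , e-inj , e-surj) =
  e , (λ k → Equivalence.to A⇔B (e-∈ k)) , e-inj ,
  λ x x∈B → e-surj x (Equivalence.from A⇔B x∈B)

module _ (S T : Setoid 0ℓ 0ℓ) where
  open Setoid S using () renaming (Carrier to X; _≈_ to _~X_)
  open Setoid T using () renaming (Carrier to Y; _≈_ to _~Y_)

  enumeration-image :
    {A : X → Set} {B : Y → Set} (φ : X → Y) →
    (∀ x x′ → A x → A x′ → x ~X x′ → φ x ~Y φ x′) →
    (∀ x x′ → A x → A x′ → φ x ~Y φ x′ → x ~X x′) →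
    (∀ x → A x → B (φ x)) →
    (∀ y → B y → Σ X λ x → A x × φ x ~Y y) →
    ∀ {N} → Enumeration S A N → Enumeration T B N
  enumeration-image φ φ-cong φ-inj φ-into φ-onto (e , e-∈ , e-inj , e-surj) =
    (λ k → φ (e k)) ,
    (λ k → φ-into (e k) (e-∈ k)) ,
    (λ k k′ φek~φek′ → e-inj k k′ (φ-inj (e k) (e k′) (e-∈ k) (e-∈ k′) φek~φek′)) ,
    λ y y∈B → let (x , x∈A , φx~y) = φ-onto y y∈B
                  (k , ek~x)       = e-surj x x∈A
              in k , Setoid.trans T (φ-cong (e k) x (e-∈ k) x∈A ek~x) φx~y

  enumeration-pairs :
    {A : Y → Set} {B : X → Set} {p : ℕ} (pair : Fin p → X → Y) →
    (∀ a {x} → B x → A (pair a x)) →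
    (∀ a {x x′} → x ~X x′ → pair a x ~Y pair a x′) →
    (∀ a a′ {x x′} → B x → B x′ → pair a x ~Y pair a′ x′ → a ≡ a′ × x ~X x′) →
    (∀ y → A y → Σ (Fin p) λ a → Σ X λ x → B x × pair a x ~Y y) →
    ∀ {M} → Enumeration S B M → Enumeration T A (p * M)
  enumeration-pairs {A} {B} {p} pair pair-∈ pair-cong pair-inj pair-surj {M}
                    (e , e-∈ , e-inj , e-surj) = enum , enum-∈ , enum-inj , enum-surj
    where
    enumPair : Fin p × Fin M → Y
    enumPair (a , b) = pair a (e b)

    enum : Fin (p * M) → Y
    enum k = enumPair (remQuot {p} M k)

    enum-∈ : ∀ k → A (enum k)
    enum-∈ k = pair-∈ (proj₁ (remQuot {p} M k)) (e-∈ (proj₂ (remQuot {p} M k)))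

    enum-inj : ∀ k k′ → enum k ~Y enum k′ → k ≡ k′
    enum-inj k k′ enum≈ =
      let (a≡a′ , eb~eb′) = pair-inj _ _ (e-∈ _) (e-∈ _) enum≈
      in trans (sym (combine-remQuot {p} M k))
               (trans (cong₂ combine a≡a′ (e-inj _ _ eb~eb′)) (combine-remQuot {p} M k′))

    enum-surj : ∀ y → A y → Σ (Fin (p * M)) λ k → enum k ~Y y
    enum-surj y y∈A =
      let (a , x , x∈B , pair~y) = pair-surj y y∈A
          (b , eb~x)             = e-surj x x∈B
      in combine a b ,
         subst (λ ab → enumPair ab ~Y y) (sym (remQuot-combine a b))
               (Setoid.trans T (pair-cong a eb~x) pair~y)

lookup-injective : {l : List (Fin n)} → Unique l →
                   ∀ {i j} → lookup l i ≡ lookup l j → i ≡ j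
lookup-injective {l = x ∷ xs} u {zero} {zero} _ = refl
lookup-injective {l = x ∷ xs} u {zero} {suc j} x≡ =
  contradiction (subst (_∈ xs) (sym x≡) (∈-lookup j)) (Unique[x∷xs]⇒x∉xs u)
lookup-injective {l = x ∷ xs} u {suc i} {zero} ≡x =
  contradiction (subst (_∈ xs) ≡x (∈-lookup i)) (Unique[x∷xs]⇒x∉xs u)
lookup-injective {l = x ∷ xs} (_ ∷ u) {suc i} {suc j} eq = cong suc (lookup-injective u eq)

module _ {n : ℕ} where
  open import Data.List.Membership.DecPropositional (_≟_ {n}) using (_∈?_)

  supportedIn-∈ : ∀ {l} {σ : Perm n} → SupportedIn l σ → ∀ {w} → w ∈ l → σ ⟨$⟩ʳ w ∈ l
  supportedIn-∈ {l} {σ} fix {w} w∈l with σ ⟨$⟩ʳ w ∈? l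
  ... | yes σw∈l = σw∈l
  ... | no σw∉l  = contradiction (subst (_∈ l) (sym σw≡w) w∈l) σw∉l
    where
    σw≡w : σ ⟨$⟩ʳ w ≡ w
    σw≡w = ⟨$⟩ʳ-injective σ (fix (σ ⟨$⟩ʳ w) σw∉l)

supportedIn-enumeration : {l : List (Fin n)} → Unique l →
                          HasCard (SupportedIn l) (length l !)
supportedIn-enumeration {l = []} _ =
  (λ _ → id) , (λ _ _ _ → refl) , (λ { zero zero _ → refl }) ,
  λ σ fix → zero , λ w → sym (fix w λ ())
supportedIn-enumeration {n} {l = d ∷ l} u@(_ ∷ u′) =
  enumeration-pairs (≈-setoid n) (≈-setoid n) pair pair-∈ pair-cong pair-inj pair-surj
                    (supportedIn-enumeration u′)
  where
  -- pair a τ is τ followed by the swap of d with the a-th vertex; as τ fixes d,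
  -- the index a records where pair a τ sends d.
  swapWith : Fin (length (d ∷ l)) → Perm n
  swapWith a = flip (transpose (lookup (d ∷ l) a) d)

  pair : Fin (length (d ∷ l)) → Perm n → Perm n
  pair a τ = τ ∘ₚ swapWith a

  pair-∈ : ∀ a {τ} → SupportedIn l τ → SupportedIn (d ∷ l) (pair a τ)
  pair-∈ a fix w w∉ =
    trans (cong (swapWith a ⟨$⟩ʳ_) (fix w (λ w∈l → w∉ (there w∈l))))
          (transpose-mismatch {u = d} {v = lookup (d ∷ l) a} (λ w≡d → w∉ (here w≡d))
            (λ w≡lka → w∉ (subst (_∈ d ∷ l) (sym w≡lka) (∈-lookup a))))

  pair-cong : ∀ a {τ τ′} → τ ≈ τ′ → pair a τ ≈ pair a τ′
  pair-cong a τ≈τ′ w = cong (swapWith a ⟨$⟩ʳ_) (τ≈τ′ w)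

  pair-at-d : ∀ a {τ} → SupportedIn l τ → pair a τ ⟨$⟩ʳ d ≡ lookup (d ∷ l) a
  pair-at-d a fix = trans (cong (swapWith a ⟨$⟩ʳ_) (fix d (Unique[x∷xs]⇒x∉xs u)))
                          (transpose-matchˡ d (lookup (d ∷ l) a))

  pair-inj : ∀ a a′ {τ τ′} → SupportedIn l τ → SupportedIn l τ′ →
             pair a τ ≈ pair a′ τ′ → a ≡ a′ × τ ≈ τ′
  pair-inj a a′ {τ} {τ′} fix fix′ pair≈
    with lookup-injective u {a} {a′}
           (trans (sym (pair-at-d a {τ} fix)) (trans (pair≈ d) (pair-at-d a′ {τ′} fix′)))
  ... | refl = refl , ∘ₚ-cancelʳ {σ = τ} {τ′} {swapWith a} pair≈

  pair-surj : ∀ σ → SupportedIn (d ∷ l) σ →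
              Σ (Fin (length (d ∷ l))) λ a → Σ (Perm n) λ τ → SupportedIn l τ × pair a τ ≈ σ
  pair-surj σ fix =
    index σd∈ , σ ∘ₚ t , supportedIn-peel {σ = σ} fix ,
    λ w → subst (λ x → flip (transpose x d) ⟨$⟩ʳ (t ⟨$⟩ʳ (σ ⟨$⟩ʳ w)) ≡ σ ⟨$⟩ʳ w)
                (lookup-index σd∈) (inverseˡ t)
    where
    σd∈ : σ ⟨$⟩ʳ d ∈ d ∷ l
    σd∈ = supportedIn-∈ {σ = σ} fix (here refl)
    t : Perm n
    t = transpose (σ ⟨$⟩ʳ d) d

family-enumeration : ∀ {s} {A : Fin s → Perm n → Set} {c : Fin s → ℕ} →
                     (∀ i → HasCard (A i) (c i)) →
                     Enumeration (≋-setoid (≈-setoid n) s) (λ f → ∀ i → A i (f i)) (∏ c)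
family-enumeration {s = zero} _ =
  (λ _ ()) , (λ _ ()) , (λ { zero zero _ → refl }) , λ _ _ → zero , λ ()
family-enumeration {n} {s = suc s} {A} {c} enums with enums zero
... | e₀ , e₀-∈ , e₀-inj , e₀-surj =
  enumeration-pairs (≋-setoid (≈-setoid n) s) (≋-setoid (≈-setoid n) (suc s))
                    pair pair-∈ pair-cong pair-inj pair-surj
                    (family-enumeration (λ i → enums (suc i)))
  where
  pair : Fin (c zero) → (Fin s → Perm n) → Fin (suc s) → Perm n
  pair a g = e₀ a Vector.∷ g

  pair-∈ : ∀ a {g} → (∀ i → A (suc i) (g i)) → ∀ i → A i (pair a g i)
  pair-∈ a g∈ zero    = e₀-∈ a
  pair-∈ a g∈ (suc i) = g∈ i

  pair-cong : ∀ a {g g′} → (∀ i → g i ≈ g′ i) → ∀ i → pair a g i ≈ pair a g′ i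
  pair-cong a g≈g′ zero    _ = refl
  pair-cong a g≈g′ (suc i)   = g≈g′ i

  pair-inj : ∀ a a′ {g g′} → (∀ i → A (suc i) (g i)) → (∀ i → A (suc i) (g′ i)) →
             (∀ i → pair a g i ≈ pair a′ g′ i) → a ≡ a′ × (∀ i → g i ≈ g′ i)
  pair-inj a a′ _ _ pair≈ = e₀-inj a a′ (pair≈ zero) , λ i → pair≈ (suc i)

  pair-surj : ∀ f → (∀ i → A i (f i)) →
              Σ (Fin (c zero)) λ a → Σ (Fin s → Perm n) λ g →
                (∀ i → A (suc i) (g i)) × (∀ i → pair a g i ≈ f i)
  pair-surj f f∈ =
    let (a , e₀a≈f₀) = e₀-surj (f zero) (f∈ zero)
    in a , Vector.tail f , (λ i → f∈ (suc i)) ,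
       λ { zero → e₀a≈f₀ ; (suc i) _ → refl }

module _ {n s : ℕ} {Γ : Graph n} (L : ClassLabeling Γ s) where

  private
    module CP = IsSubgroup (classPreserving-isSubgroup (cls L))

  -- A vertex v ∈ Cᵢ with σ v ∉ Cᵢ is impossible: σ would fix σ v, hence v = σ v.
  inSym⇒classPreserving : ∀ {i} σ → InSym L i σ → ClassPreserving (cls L) σ
  inSym⇒classPreserving {i} σ fix v with cls L v ≟ i
  ... | no v∉Cᵢ  = cong (cls L) (fix v v∉Cᵢ)
  ... | yes v∈Cᵢ with cls L (σ ⟨$⟩ʳ v) ≟ i
  ...   | yes σv∈Cᵢ = trans σv∈Cᵢ (sym v∈Cᵢ)
  ...   | no σv∉Cᵢ  = contradiction
          (trans (cong (cls L) (⟨$⟩ʳ-injective σ (fix (σ ⟨$⟩ʳ v) σv∉Cᵢ))) v∈Cᵢ) σv∉Cᵢ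

  inSym-∘ : ∀ {i σ τ} → InSym L i σ → InSym L i τ → InSym L i (σ ∘ₚ τ)
  inSym-∘ {τ = τ} σ∈ τ∈ w w∉Cᵢ = trans (cong (τ ⟨$⟩ʳ_) (σ∈ w w∉Cᵢ)) (τ∈ w w∉Cᵢ)

  transpose-inSym : ∀ {u v} → cls L u ≡ cls L v → InSym L (cls L u) (transpose u v)
  transpose-inSym cu≡cv w w∉Cᵤ =
    transpose-mismatch (λ w≡u → w∉Cᵤ (cong (cls L) w≡u))
                       (λ w≡v → w∉Cᵤ (trans (cong (cls L) w≡v) (sym cu≡cv)))

  SEP⇔classPreserving : ∀ σ → SEP Γ σ ⇔ ClassPreserving (cls L) σ
  SEP⇔classPreserving σ = mk⇔
    (Gen-minimal (classPreserving-isSubgroup (cls L))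
       λ { {τ} (u , v , u~v , τ≈uv) →
           CP.≈-∈ {transpose u v} {τ} (λ w → sym (τ≈uv w))
                  (transpose-classPreserving (cls L) (Equivalence.from (cls-spec L u v) u~v)) })
    (classPreserving⇒Gen (cls L)
       λ {u} {v} cu≡cv → gen (u , v , Equivalence.to (cls-spec L u v) cu≡cv , λ _ → refl))

  GenInUnion⇔classPreserving : ∀ σ → Gen (InUnion L) σ ⇔ ClassPreserving (cls L) σ
  GenInUnion⇔classPreserving σ = mk⇔
    (Gen-minimal (classPreserving-isSubgroup (cls L))
       λ {τ} (_ , τ∈) → inSym⇒classPreserving τ τ∈)
    (classPreserving⇒Gen (cls L) λ {u} cu≡cv → gen (cls L u , transpose-inSym cu≡cv))

  glue : (f : Fin s → Perm n) → (∀ i → ClassPreserving (cls L) (f i)) → Perm n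
  glue f f-cp = permutation (λ v → f (cls L v) ⟨$⟩ʳ v) (λ v → f (cls L v) ⟨$⟩ˡ v)
                            glue-from glue-to
    where
    glue-from : ∀ v → f (cls L (f (cls L v) ⟨$⟩ˡ v)) ⟨$⟩ʳ (f (cls L v) ⟨$⟩ˡ v) ≡ v
    glue-from v =
      trans (cong (λ i → f i ⟨$⟩ʳ (f (cls L v) ⟨$⟩ˡ v))
                  (CP.flip-∈ {f (cls L v)} (f-cp (cls L v)) v))
            (inverseʳ (f (cls L v)))
    glue-to : ∀ v → f (cls L (f (cls L v) ⟨$⟩ʳ v)) ⟨$⟩ˡ (f (cls L v) ⟨$⟩ʳ v) ≡ v
    glue-to v = trans (cong (λ i → f i ⟨$⟩ˡ (f (cls L v) ⟨$⟩ʳ v)) (f-cp (cls L v) v))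
                      (inverseˡ (f (cls L v)))

  classPreserving? : ∀ σ → Dec (ClassPreserving (cls L) σ)
  classPreserving? σ = all? λ v → cls L (σ ⟨$⟩ʳ v) ≟ cls L v

  -- Only families of class-preserving permutations are glued; on all others
  -- assemble returns the junk value id.
  assemble : (Fin s → Perm n) → Perm n
  assemble f with all? (λ i → classPreserving? (f i))
  ... | yes f-cp = glue f f-cp
  ... | no _     = id

  assemble-apply : ∀ {f} → InProd L f → ∀ v → assemble f ⟨$⟩ʳ v ≡ f (cls L v) ⟨$⟩ʳ v
  assemble-apply {f} f∈ v with all? (λ i → classPreserving? (f i))
  ... | yes _    = refl
  ... | no ¬f-cp = contradiction (λ i → inSym⇒classPreserving (f i) (f∈ i)) ¬f-cp

  onlyAt : Fin s → Perm n → Fin s → Perm n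
  onlyAt i σ j with j ≟ i
  ... | yes _ = σ
  ... | no _  = id

  onlyAt-classPreserving : ∀ {i σ} → ClassPreserving (cls L) σ →
                           ∀ j → ClassPreserving (cls L) (onlyAt i σ j)
  onlyAt-classPreserving {i} σ-cp j with j ≟ i
  ... | yes _ = σ-cp
  ... | no _  = λ _ → refl

  restrict : ∀ σ → ClassPreserving (cls L) σ → Fin s → Perm n
  restrict σ σ-cp i = glue (onlyAt i σ) (onlyAt-classPreserving σ-cp)

  restrict-inSym : ∀ σ (σ-cp : ClassPreserving (cls L) σ) → InProd L (restrict σ σ-cp)
  restrict-inSym σ σ-cp i w w∉Cᵢ with cls L w ≟ i
  ... | yes w∈Cᵢ = contradiction w∈Cᵢ w∉Cᵢ
  ... | no _     = refl

  restrict-agrees : ∀ σ (σ-cp : ClassPreserving (cls L) σ) v →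
                    restrict σ σ-cp (cls L v) ⟨$⟩ʳ v ≡ σ ⟨$⟩ʳ v
  restrict-agrees σ σ-cp v with cls L v ≟ cls L v
  ... | yes _    = refl
  ... | no cv≢cv = contradiction refl cv≢cv

  assemble-hom : ∀ f g → InProd L f → InProd L g →
                 assemble (λ i → f i ∘ₚ g i) ≈ (assemble f ∘ₚ assemble g)
  assemble-hom f g f∈ g∈ v = begin
    assemble (λ i → f i ∘ₚ g i) ⟨$⟩ʳ v
      ≡⟨ assemble-apply (λ i → inSym-∘ {σ = f i} {g i} (f∈ i) (g∈ i)) v ⟩
    g (cls L v) ⟨$⟩ʳ (f (cls L v) ⟨$⟩ʳ v)
      ≡⟨ cong (λ i → g i ⟨$⟩ʳ (f (cls L v) ⟨$⟩ʳ v))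
              (sym (inSym⇒classPreserving (f (cls L v)) (f∈ (cls L v)) v)) ⟩
    g (cls L (f (cls L v) ⟨$⟩ʳ v)) ⟨$⟩ʳ (f (cls L v) ⟨$⟩ʳ v)
      ≡⟨ sym (assemble-apply g∈ (f (cls L v) ⟨$⟩ʳ v)) ⟩
    assemble g ⟨$⟩ʳ (f (cls L v) ⟨$⟩ʳ v)
      ≡⟨ cong (assemble g ⟨$⟩ʳ_) (sym (assemble-apply f∈ v)) ⟩
    assemble g ⟨$⟩ʳ (assemble f ⟨$⟩ʳ v)
      ∎
    where open ≡-Reasoning

  assemble-inj : ∀ f g → InProd L f → InProd L g → assemble f ≈ assemble g →
                 ∀ i → f i ≈ g i
  assemble-inj f g f∈ g∈ assemble≈ i w with cls L w ≟ i
  ... | yes refl = trans (sym (assemble-apply f∈ w)) (trans (assemble≈ w) (assemble-apply g∈ w))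
  ... | no w∉Cᵢ  = trans (f∈ i w w∉Cᵢ) (sym (g∈ i w w∉Cᵢ))

  productIso : ProdIso L
  productIso = record
    { ψ      = assemble
    ; ψ-resp = λ f g f∈ g∈ f≈g v →
        trans (assemble-apply f∈ v) (trans (f≈g (cls L v) v) (sym (assemble-apply g∈ v)))
    ; ψ-hom  = assemble-hom
    ; ψ-inj  = assemble-inj
    ; ψ-into = λ f f∈ → Equivalence.from (SEP⇔classPreserving (assemble f)) λ v →
        trans (cong (cls L) (assemble-apply f∈ v))
              (inSym⇒classPreserving (f (cls L v)) (f∈ (cls L v)) v)
    ; ψ-onto = λ σ σ∈ →
        let σ-cp = Equivalence.to (SEP⇔classPreserving σ) σ∈
        in restrict σ σ-cp , restrict-inSym σ σ-cp ,
           λ v → trans (assemble-apply (restrict-inSym σ σ-cp) v) (restrict-agrees σ σ-cp v)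
    }

  inSym-enumeration : ∀ i → HasCard (InSym L i) (classSize L i !)
  inSym-enumeration i =
    enumeration-cong (≈-setoid n)
                     (λ {σ} → mk⇔ (supported⇒inSym {σ}) (inSym⇒supported {σ}))
                     (supportedIn-enumeration (filter⁺ Cᵢ? (allFin⁺ n)))
    where
    Cᵢ? : ∀ v → Dec (cls L v ≡ i)
    Cᵢ? v = cls L v ≟ i
    supported⇒inSym : ∀ {σ} → SupportedIn (filter Cᵢ? (allFin n)) σ → InSym L i σ
    supported⇒inSym fix w w∉Cᵢ =
      fix w λ w∈ → w∉Cᵢ (proj₂ (∈-filter⁻ Cᵢ? {xs = allFin n} w∈))
    inSym⇒supported : ∀ {σ} → InSym L i σ → SupportedIn (filter Cᵢ? (allFin n)) σ
    inSym⇒supported σ∈ w w∉ = σ∈ w λ w∈Cᵢ → w∉ (∈-filter⁺ Cᵢ? (∈-allFin w) w∈Cᵢ)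

theorem2p3 : ∀ (n : ℕ) (Γ : Graph n) (s : ℕ) (L : ClassLabeling Γ s) →
    (∀ σ → SEP Γ σ ⇔ Gen (InUnion L) σ)
    × ProdIso L
    × HasCard (SEP Γ) (∏ (λ i → classSize L i !))
theorem2p3 n Γ s L =
  (λ σ → ⇔-sym (GenInUnion⇔classPreserving L σ) ⇔-∘ SEP⇔classPreserving L σ) ,
  productIso L ,
  enumeration-image (≋-setoid (≈-setoid n) s) (≈-setoid n) ψ ψ-resp ψ-inj ψ-into ψ-onto
                    (family-enumeration (inSym-enumeration L))
  where open ProdIso (productIso L)
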